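{- Let $p,q$ be integers with $p\geq q\geq 2$, and write $p-1=t(q-1)+r$ with $t=\left\lfloor \frac{p-1}{q-1}\right\rfloor$ and $0\leq r<q-1$. Let $n,k$ be positive integers with $n\geq t\geq 2$. Let $\mathcal{H}$ be a $k$-uniform hypergraph on vertex set $[n]=\{1,\dots,n\}$ whose edge set consists of all $k$-subsets $A\subseteq[n]$ with $A\cap[t]\neq\emptyset$ together with exactly $r$ further $k$-subsets of $[n]$ disjoint from $[t]$. Then $\mathcal{H}$ satisfies the $(p,q)$-property.
   Context: A $k$-uniform hypergraph satisfies the $(p,q)$-property if among any $p$ of its edges some $q$ of them have a common vertex. -}

module Defs where

open import Data.Nat using (ℕ; _<_)
open import Data.Fin using (Fin; toℕ)
open import Data.Fin.Subset using (Subset; _∈_; ∣_∣)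
open import Data.Product using (Σ; ∃; _×_)
open import Data.Sum using (_⊎_)
open import Relation.Binary.PropositionalEquality using (_≡_)
open import Function.Definitions using (Injective)

-- Vertex set [n] is Fin n; vertex i : Fin n stands for the integer toℕ i + 1,
-- so [t] = {1..t} corresponds to { i | toℕ i < t }.

PQProperty : (n : ℕ) → (Subset n → Set) → ℕ → ℕ → Set
PQProperty n E p q =
  (e : Fin p → Subset n) → Injective _≡_ _≡_ e → (∀ i → E (e i)) →
  Σ (Fin q → Fin p) λ σ → Injective _≡_ _≡_ σ × ∃ λ (v : Fin n) → ∀ j → v ∈ e (σ j)

MeetsFirst : {n : ℕ} → ℕ → Subset n → Set
MeetsFirst {n} t A = ∃ λ (v : Fin n) → toℕ v < t × v ∈ A

HEdge : (n k t r : ℕ) → (Fin r → Subset n) → Subset n → Set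
HEdge n k t r R A = (∣ A ∣ ≡ k × MeetsFirst t A) ⊎ ∃ λ (j : Fin r) → R j ≡ A

-- Every edge of H avoiding [t] is one of the r extra sets, so at most r of any p distinct
-- edges avoid [t]. Labelling each of the remaining edges by one of its vertices in [t]
-- gives more than t(q-1) edges in t classes, so by pigeonhole q of them share a label,
-- i.e. a common vertex.
module Submission where

open import Data.Nat using (ℕ; zero; suc; _+_; _*_; _∸_; _≤_; _<_; s≤s; s≤s⁻¹; _≟_; _<?_)
open import Data.Nat.Properties
  using (n<1+n; m<n⇒m<1+n; ≤-trans; <-≤-trans; ≤-reflexive; <-irrefl; +-suc;
         +-monoˡ-≤; +-monoʳ-≤; +-cancelʳ-<; ≤∧≢⇒<; +-cancelˡ-<; ≮⇒≥; module ≤-Reasoning)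
open import Data.Fin using (Fin; zero; suc; toℕ; fromℕ<; inject≤)
open import Data.Fin.Properties using (any?; toℕ-injective; toℕ-fromℕ<; inject≤-injective; injective⇒≤)
open import Data.Fin.Subset using (Subset; _∈_; _∉_; ∣_∣)
open import Data.Fin.Subset.Properties using (_∈?_)
open import Data.List using (List; []; _∷_; length; filter; lookup; allFin)
open import Data.List.Properties using (length-tabulate)
open import Data.List.Membership.Propositional.Properties using (∈-lookup)
open import Data.List.Relation.Unary.All as All using (All; _∷_)
open import Data.List.Relation.Unary.All.Properties using (all-filter)
import Data.List.Relation.Unary.All.Properties as AllP
open import Data.List.Relation.Unary.AllPairs using (_∷_)
open import Data.List.Relation.Unary.Unique.Propositional using (Unique)
import Data.List.Relation.Unary.Unique.Propositional.Properties as Unique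
open import Data.List.Relation.Binary.Sublist.Propositional.Properties using (filter⁺; filter-⊆; length-mono-≤)
open import Data.Product using (Σ; ∃; _×_; _,_; proj₁)
open import Data.Sum using (inj₁; inj₂)
open import Level using (Level)
open import Relation.Nullary using (¬_; yes; no; contradiction)
open import Relation.Nullary.Decidable using (_×-dec_)
open import Relation.Unary using (Pred; Decidable)
open import Relation.Unary.Properties using (∁?)
open import Relation.Binary.PropositionalEquality using (_≡_; refl; sym; trans; cong; subst)
open import Function using (id; _∘_)
open import Function.Definitions using (Injective)

open import Defs

private
  variable
    ℓ : Level
    A : Set

module _ {P : Pred A ℓ} (P? : Decidable P) where

  length-filter-∁ : ∀ xs → length (filter P? xs) + length (filter (∁? P?) xs) ≡ length xs
  length-filter-∁ [] = refl
  length-filter-∁ (x ∷ xs) with P? x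
  ... | yes _ = cong suc (length-filter-∁ xs)
  ... | no _ = trans (+-suc _ _) (cong suc (length-filter-∁ xs))

lookup-injective : {xs : List A} → Unique xs → Injective _≡_ _≡_ (lookup xs)
lookup-injective {xs = _ ∷ _} _ {zero} {zero} _ = refl
lookup-injective {xs = _ ∷ _} (x∉xs ∷ _) {zero} {suc j} eq = contradiction eq (All.lookup x∉xs (∈-lookup j))
lookup-injective {xs = _ ∷ _} (x∉xs ∷ _) {suc i} {zero} eq = contradiction (sym eq) (All.lookup x∉xs (∈-lookup i))
lookup-injective {xs = _ ∷ _} (_ ∷ u) {suc i} {suc j} eq = cong suc (lookup-injective u eq)

Unique⇒length≤ : {m : ℕ} {P : Pred A ℓ} {xs : List A} (f : ∀ {x} → P x → Fin m) →
                 (∀ {x y} (px : P x) (py : P y) → f px ≡ f py → x ≡ y) →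
                 Unique xs → All P xs → length xs ≤ m
Unique⇒length≤ f f-inj u ps =
  injective⇒≤ {f = λ i → f (All.lookup ps (∈-lookup i))} (λ eq → lookup-injective u (f-inj _ _ eq))

Unique⇒injection : {q : ℕ} {P : Pred A ℓ} {xs : List A} → Unique xs → q ≤ length xs → All P xs →
                   Σ (Fin q → A) λ σ → Injective _≡_ _≡_ σ × (∀ j → P (σ j))
Unique⇒injection {xs = xs} u q≤|xs| ps =
  (λ j → lookup xs (inject≤ j q≤|xs|)) ,
  (λ eq → inject≤-injective q≤|xs| q≤|xs| _ _ (lookup-injective u eq)) ,
  (λ j → All.lookup ps (∈-lookup _))

length-filter-filter≤ : {P Q : Pred A ℓ} (P? : Decidable P) (Q? : Decidable Q) (xs : List A) →
                        length (filter Q? (filter P? xs)) ≤ length (filter Q? xs)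
length-filter-filter≤ P? Q? xs = length-mono-≤ (filter⁺ Q? Q? (λ { refl → id }) (filter-⊆ P? xs))

pigeonhole : (c : A → ℕ) (m s : ℕ) (xs : List A) → All (λ x → c x < m) xs → m * s < length xs →
             ∃ λ a → a < m × s < length (filter (λ x → c x ≟ a) xs)
pigeonhole c zero s [] _ ()
pigeonhole c zero s (_ ∷ _) (() ∷ _) _
pigeonhole c (suc m) s xs c<1+m big with s <? length (filter (λ x → c x ≟ m) xs)
... | yes many = m , n<1+n m , many
... | no few =
  let a , a<m , many = pigeonhole c m s rest rest-bounded rest-big
  in a , m<n⇒m<1+n a<m , ≤-trans many (length-filter-filter≤ _ _ xs)
  where
  rest : List _
  rest = filter (∁? (λ x → c x ≟ m)) xs

  rest-bounded : All (λ x → c x < m) rest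
  rest-bounded = All.zipWith (λ (c<1+m , c≢m) → ≤∧≢⇒< (s≤s⁻¹ c<1+m) c≢m)
                   (AllP.filter⁺ _ c<1+m , all-filter _ xs)

  rest-big : m * s < length rest
  rest-big = +-cancelˡ-< s _ _ (begin-strict
    s + m * s                                          <⟨ big ⟩
    length xs                                          ≡⟨ sym (length-filter-∁ _ xs) ⟩
    length (filter (λ x → c x ≟ m) xs) + length rest   ≤⟨ +-monoˡ-≤ _ (≮⇒≥ few) ⟩
    s + length rest                                    ∎)
    where open ≤-Reasoning

module _ {n : ℕ} (t : ℕ) where

  meetsFirst? : Decidable (MeetsFirst {n} t)
  meetsFirst? A = any? (λ v → toℕ v <? t ×-dec v ∈? A)

  label : Subset n → ℕ
  label A with meetsFirst? A
  ... | yes (v , _) = toℕ v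
  ... | no _ = t

  meetsFirst⇒label< : ∀ {A} → MeetsFirst t A → label A < t
  meetsFirst⇒label< {A} meets with meetsFirst? A
  ... | yes (_ , v<t , _) = v<t
  ... | no avoids = contradiction meets avoids

  label<⇒∈ : ∀ A → label A < t → ∃ λ v → toℕ v ≡ label A × v ∈ A
  label<⇒∈ A l<t with meetsFirst? A
  ... | yes (v , _ , v∈A) = v , refl , v∈A
  ... | no _ = contradiction l<t (<-irrefl refl)

avoidsFirst⇒extra : {n k t r : ℕ} {R : Fin r → Subset n} {A : Subset n} →
                    HEdge n k t r R A → ¬ MeetsFirst t A → ∃ λ j → R j ≡ A
avoidsFirst⇒extra (inj₁ (_ , meets)) avoids = contradiction meets avoids
avoidsFirst⇒extra (inj₂ extra) _ = extra

module _ {p n k t r : ℕ} {R : Fin r → Subset n} (e : Fin p → Subset n)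
         (e-inj : Injective _≡_ _≡_ e) (e∈H : ∀ i → HEdge n k t r R (e i)) where

  meeting avoiding : List (Fin p)
  meeting = filter (λ i → meetsFirst? t (e i)) (allFin p)
  avoiding = filter (∁? (λ i → meetsFirst? t (e i))) (allFin p)

  length-avoiding≤ : length avoiding ≤ r
  length-avoiding≤ = Unique⇒length≤ proj₁ sameExtra⇒≡
    (Unique.filter⁺ _ (Unique.allFin⁺ p)) (All.map (λ {i} → avoidsFirst⇒extra (e∈H i)) (all-filter _ (allFin p)))
    where
    sameExtra⇒≡ : ∀ {x y} (ex : ∃ λ j → R j ≡ e x) (ey : ∃ λ j → R j ≡ e y) → proj₁ ex ≡ proj₁ ey → x ≡ y
    sameExtra⇒≡ (_ , Rj≡ex) (_ , Rj≡ey) refl = e-inj (trans (sym Rj≡ex) Rj≡ey)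

  length-meeting> : ∀ s → t * s + r < p → t * s < length meeting
  length-meeting> s big = +-cancelʳ-< _ _ _ (begin-strict
    t * s + r                            <⟨ big ⟩
    p                                    ≡⟨ sym (length-tabulate id) ⟩
    length (allFin p)                    ≡⟨ sym (length-filter-∁ _ (allFin p)) ⟩
    length meeting + length avoiding     ≤⟨ +-monoʳ-≤ _ length-avoiding≤ ⟩
    length meeting + r                   ∎)
    where open ≤-Reasoning

  sharedVertex : ∀ s → t ≤ n → t * s < length meeting →
                 Σ (Fin (suc s) → Fin p) λ σ → Injective _≡_ _≡_ σ × ∃ λ v → ∀ j → v ∈ e (σ j)
  sharedVertex s t≤n big with pigeonhole (label t ∘ e) t s meeting labelled big
    where
    labelled : All (λ i → label t (e i) < t) meeting
    labelled = All.map (meetsFirst⇒label< t) (all-filter _ (allFin p))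
  ... | a , a<t , many =
    let σ , σ-inj , v∈eσ = Unique⇒injection unique many sharing in σ , σ-inj , v , v∈eσ
    where
    v : Fin n
    v = fromℕ< (<-≤-trans a<t t≤n)

    unique : Unique (filter (λ i → label t (e i) ≟ a) meeting)
    unique = Unique.filter⁺ _ (Unique.filter⁺ _ (Unique.allFin⁺ p))

    labelled-a⇒∋v : ∀ {i} → label t (e i) ≡ a → v ∈ e i
    labelled-a⇒∋v {i} l≡a with label<⇒∈ t (e i) (subst (_< t) (sym l≡a) a<t)
    ... | w , w≡l , w∈ei = subst (_∈ e i) (toℕ-injective (trans w≡l (trans l≡a (sym (toℕ-fromℕ< _))))) w∈ei

    sharing : All (λ i → v ∈ e i) (filter (λ i → label t (e i) ≟ a) meeting)
    sharing = All.map labelled-a⇒∋v (all-filter _ meeting)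

mainTheorem2 : (p q t r n k : ℕ) → 2 ≤ q → q ≤ p →
    p ∸ 1 ≡ t * (q ∸ 1) + r → r < q ∸ 1 →
    1 ≤ n → 1 ≤ k → 2 ≤ t → t ≤ n →
    (R : Fin r → Subset n) → Injective _≡_ _≡_ R →
    (∀ j → ∣ R j ∣ ≡ k) →
    (∀ j (v : Fin n) → toℕ v < t → v ∉ R j) →
    PQProperty n (HEdge n k t r R) p q
mainTheorem2 (suc p) (suc q) t r n k (s≤s _) (s≤s _) p≡ _ _ _ _ t≤n R _ _ _ e e-inj e∈H =
  sharedVertex e e-inj e∈H q t≤n (length-meeting> e e-inj e∈H q (s≤s (≤-reflexive (sym p≡))))
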